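{- For $n\ge1$ and any prime $p$, \[ Q_p(n) = \Phi_p^n\, \Delta_{p-1}^n\, S_\nu(p)\big|_{\nu=0}, \] that is, $Q_p(n) = p^{ -n}\sum_{j=0}^{n}\binom{n}{j}(-1)^{n-j} S_{j(p-1)}(p)$.
   Context: For a prime $p$ and $a$ coprime to $p$, $q_p(a)=\frac{a^{p-1}-1}{p}$ and $Q_p(n)=\sum_{a=1}^{p-1}q_p(a)^n$. Power sums: $S_n(m)=\sum_{\nu=1}^{m-1}\nu^n$ for $n\ge1$, and by convention $S_0(m)=m-1$. The forward difference operator with step $h$ is $\Delta_h^n f(s)=\sum_{\nu=0}^n\binom{n}{\nu}(-1)^{n-\nu}f(s+\nu h)$, applied here to $f(\nu)=S_\nu(p)$ at $\nu=0$. $\Phi_p: p\mathbb{Z}_p\to\mathbb{Z}_p$, $a\mapsto a/p$, is the $p$-adic backward shift. -}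

module Defs where

open import Data.Nat as ℕ using (ℕ; zero; suc; NonZero)
open import Data.Nat.Combinatorics using (_C_)
open import Data.Integer as ℤ using (ℤ; +_)
open import Data.Rational as ℚ using (ℚ; _/_)

_^ℚ_ : ℚ → ℕ → ℚ
x ^ℚ zero  = ℚ.1ℚ
x ^ℚ suc n = x ℚ.* (x ^ℚ n)

sumFrom : ℕ → ℕ → (ℕ → ℚ) → ℚ
sumFrom lo zero      f = ℚ.0ℚ
sumFrom lo (suc len) f = f lo ℚ.+ sumFrom (suc lo) len f

sum1 : ℕ → (ℕ → ℚ) → ℚ
sum1 m f = sumFrom 1 (m ℕ.∸ 1) f

sum0 : ℕ → (ℕ → ℚ) → ℚ
sum0 n f = sumFrom 0 (suc n) f

ℕtoℚ : ℕ → ℚ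
ℕtoℚ k = (+ k) / 1

fermatQuotient : (p : ℕ) → .{{NonZero p}} → ℕ → ℚ
fermatQuotient p a = ((+ (a ℕ.^ (p ℕ.∸ 1))) ℤ.- (+ 1)) / p

Q : (p : ℕ) → .{{NonZero p}} → ℕ → ℚ
Q p n = sum1 p (λ a → fermatQuotient p a ^ℚ n)

-- Power sum S_n(m) = Σ_{ν=1}^{m-1} ν^n  (for n = 0 this is m-1, matching the convention)
S : ℕ → ℕ → ℚ
S n m = sum1 m (λ ν → ℕtoℚ (ν ℕ.^ n))

sign : ℕ → ℚ
sign k = (ℚ.- ℚ.1ℚ) ^ℚ k

{-# OPTIONS --safe #-}
module Submission where

-- Since q_p(a) = (a^(p-1) - 1)/p, the binomial theorem gives
-- q_p(a)^n = p^(-n) Σ_j C(n,j) (-1)^(n-j) a^(j(p-1)); summing over 1 ≤ a ≤ p-1 and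
-- exchanging the two finite sums turns each inner sum into the power sum S_{j(p-1)}(p).

open import Defs
open import Data.Nat as ℕ using (ℕ; NonZero; _≥_; _∸_; zero; suc)
open import Data.Nat.Primality using (Prime)
open import Data.Nat.Properties using (m^n≢0)
open import Data.Nat.Combinatorics using (_C_)
open import Data.Rational as ℚ using (ℚ; _/_; fromℚᵘ; toℚᵘ; 1ℚ)
open import Data.Integer using (+_)
open import Relation.Binary.PropositionalEquality using (_≡_)

import Data.Nat.Properties as ℕₚ
import Data.Integer as ℤ
import Data.Integer.Properties as ℤₚ
open import Data.Integer.Tactic.RingSolver using (solve-∀)
import Data.Rational.Properties as ℚₚ
open import Data.Rational.Unnormalised as ℚᵘ using (mkℚᵘ; *≡*)
import Data.Rational.Unnormalised.Properties as ℚᵘₚ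
open import Data.Fin using (Fin; toℕ)
open import Algebra.Bundles using (CommutativeRing; CommutativeSemiring)
open import Relation.Binary.PropositionalEquality
  using (refl; sym; trans; cong; cong₂; module ≡-Reasoning)
open ≡-Reasoning

ℚ-commutativeSemiring : CommutativeSemiring _ _
ℚ-commutativeSemiring = CommutativeRing.commutativeSemiring ℚₚ.+-*-commutativeRing

open CommutativeSemiring ℚ-commutativeSemiring using (semiring)
open import Algebra.Properties.Semiring.Sum semiring
  using (sum-cong-≗; ∑-comm; *-distribˡ-sum; sum-syntax; sum⁺-syntax)
open import Algebra.Properties.Semiring.Exp semiring using (_^_)
open import Algebra.Properties.Semiring.Mult semiring using (_×_; ×-assoc-*)
import Algebra.Properties.CommutativeSemiring.Exp ℚ-commutativeSemiring as Exp
import Algebra.Properties.CommutativeSemiring.Binomial ℚ-commutativeSemiring as Binomial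

fromℚᵘ-homo-+ : ∀ x y → fromℚᵘ (x ℚᵘ.+ y) ≡ fromℚᵘ x ℚ.+ fromℚᵘ y
fromℚᵘ-homo-+ x y = begin
  fromℚᵘ (x ℚᵘ.+ y)
    ≡⟨ ℚₚ.fromℚᵘ-cong (ℚᵘₚ.+-cong (ℚᵘₚ.≃-sym (ℚₚ.toℚᵘ-fromℚᵘ x)) (ℚᵘₚ.≃-sym (ℚₚ.toℚᵘ-fromℚᵘ y))) ⟩
  fromℚᵘ (toℚᵘ (fromℚᵘ x) ℚᵘ.+ toℚᵘ (fromℚᵘ y))
    ≡⟨ ℚₚ.fromℚᵘ-cong (ℚᵘₚ.≃-sym (ℚₚ.toℚᵘ-homo-+ (fromℚᵘ x) (fromℚᵘ y))) ⟩
  fromℚᵘ (toℚᵘ (fromℚᵘ x ℚ.+ fromℚᵘ y))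
    ≡⟨ ℚₚ.fromℚᵘ-toℚᵘ _ ⟩
  fromℚᵘ x ℚ.+ fromℚᵘ y ∎

fromℚᵘ-homo-* : ∀ x y → fromℚᵘ (x ℚᵘ.* y) ≡ fromℚᵘ x ℚ.* fromℚᵘ y
fromℚᵘ-homo-* x y = begin
  fromℚᵘ (x ℚᵘ.* y)
    ≡⟨ ℚₚ.fromℚᵘ-cong (ℚᵘₚ.*-cong (ℚᵘₚ.≃-sym (ℚₚ.toℚᵘ-fromℚᵘ x)) (ℚᵘₚ.≃-sym (ℚₚ.toℚᵘ-fromℚᵘ y))) ⟩
  fromℚᵘ (toℚᵘ (fromℚᵘ x) ℚᵘ.* toℚᵘ (fromℚᵘ y))
    ≡⟨ ℚₚ.fromℚᵘ-cong (ℚᵘₚ.≃-sym (ℚₚ.toℚᵘ-homo-* (fromℚᵘ x) (fromℚᵘ y))) ⟩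
  fromℚᵘ (toℚᵘ (fromℚᵘ x ℚ.* fromℚᵘ y))
    ≡⟨ ℚₚ.fromℚᵘ-toℚᵘ _ ⟩
  fromℚᵘ x ℚ.* fromℚᵘ y ∎

/-distribʳ-+ : ∀ i j n .{{_ : NonZero n}} → (i ℤ.+ j) / n ≡ i / n ℚ.+ j / n
/-distribʳ-+ i j (suc n) = begin
  fromℚᵘ (mkℚᵘ (i ℤ.+ j) n)
    ≡⟨ ℚₚ.fromℚᵘ-cong {mkℚᵘ (i ℤ.+ j) n} {mkℚᵘ i n ℚᵘ.+ mkℚᵘ j n} (*≡* cross-multiplied) ⟩
  fromℚᵘ (mkℚᵘ i n ℚᵘ.+ mkℚᵘ j n)
    ≡⟨ fromℚᵘ-homo-+ (mkℚᵘ i n) (mkℚᵘ j n) ⟩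
  fromℚᵘ (mkℚᵘ i n) ℚ.+ fromℚᵘ (mkℚᵘ j n) ∎
  where
  d = + suc n
  common-denominator : ∀ i j d → (i ℤ.+ j) ℤ.* (d ℤ.* d) ≡ (i ℤ.* d ℤ.+ j ℤ.* d) ℤ.* d
  common-denominator = solve-∀
  cross-multiplied : (i ℤ.+ j) ℤ.* + (suc n ℕ.* suc n) ≡ (i ℤ.* d ℤ.+ j ℤ.* d) ℤ.* d
  cross-multiplied = trans (cong ((i ℤ.+ j) ℤ.*_) (ℤₚ.pos-* (suc n) (suc n))) (common-denominator i j d)

/-*-/ : ∀ i j m n .{{_ : NonZero m}} .{{_ : NonZero n}} →
        (i / m) ℚ.* (j / n) ≡ ((i ℤ.* j) / (m ℕ.* n)) {{ℕₚ.m*n≢0 m n}}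
/-*-/ i j (suc m) (suc n) = sym (fromℚᵘ-homo-* (mkℚᵘ i m) (mkℚᵘ j n))

ℕtoℚ-homo-+ : ∀ m n → ℕtoℚ (m ℕ.+ n) ≡ ℕtoℚ m ℚ.+ ℕtoℚ n
ℕtoℚ-homo-+ m n = /-distribʳ-+ (+ m) (+ n) 1

ℕtoℚ-homo-* : ∀ m n → ℕtoℚ (m ℕ.* n) ≡ ℕtoℚ m ℚ.* ℕtoℚ n
ℕtoℚ-homo-* m n = trans (cong (_/ 1) (ℤₚ.pos-* m n)) (sym (/-*-/ (+ m) (+ n) 1 1))

^ℚ≡^ : ∀ x n → x ^ℚ n ≡ x ^ n
^ℚ≡^ x zero    = refl
^ℚ≡^ x (suc n) = cong (x ℚ.*_) (^ℚ≡^ x n)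

ℕtoℚ-homo-^ : ∀ m n → ℕtoℚ (m ℕ.^ n) ≡ ℕtoℚ m ^ℚ n
ℕtoℚ-homo-^ m zero    = refl
ℕtoℚ-homo-^ m (suc n) = trans (ℕtoℚ-homo-* m (m ℕ.^ n)) (cong (ℕtoℚ m ℚ.*_) (ℕtoℚ-homo-^ m n))

ℕtoℚ≡×1 : ∀ m → ℕtoℚ m ≡ m × 1ℚ
ℕtoℚ≡×1 zero    = refl
ℕtoℚ≡×1 (suc m) = trans (ℕtoℚ-homo-+ 1 m) (cong (1ℚ ℚ.+_) (ℕtoℚ≡×1 m))

×≡ℕtoℚ-* : ∀ m x → m × x ≡ ℕtoℚ m ℚ.* x
×≡ℕtoℚ-* m x = begin
  m × x            ≡⟨ cong (m ×_) (ℚₚ.*-identityˡ x) ⟨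
  m × (1ℚ ℚ.* x)   ≡⟨ ×-assoc-* m 1ℚ x ⟨
  (m × 1ℚ) ℚ.* x   ≡⟨ cong (ℚ._* x) (ℕtoℚ≡×1 m) ⟨
  ℕtoℚ m ℚ.* x     ∎

^ℚ-distrib-* : ∀ x y n → (x ℚ.* y) ^ℚ n ≡ x ^ℚ n ℚ.* y ^ℚ n
^ℚ-distrib-* x y n = begin
  (x ℚ.* y) ^ℚ n    ≡⟨ ^ℚ≡^ (x ℚ.* y) n ⟩
  (x ℚ.* y) ^ n     ≡⟨ Exp.^-distrib-* x y n ⟩
  x ^ n ℚ.* y ^ n   ≡⟨ cong₂ ℚ._*_ (^ℚ≡^ x n) (^ℚ≡^ y n) ⟨
  x ^ℚ n ℚ.* y ^ℚ n ∎

1/-^ℚ : ∀ m n .{{_ : NonZero m}} → ((+ 1) / m) ^ℚ n ≡ ((+ 1) / (m ℕ.^ n)) {{m^n≢0 m n}}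
1/-^ℚ m zero    = refl
1/-^ℚ m (suc n) {{m≢0}} =
  trans (cong ((+ 1 / m) ℚ.*_) (1/-^ℚ m n)) (/-*-/ (+ 1) (+ 1) m (m ℕ.^ n) {{m≢0}} {{m^n≢0 m n}})

sumFrom≡∑ : ∀ lo len (f : ℕ → ℚ) → sumFrom lo len f ≡ ∑[ i < len ] f (lo ℕ.+ toℕ i)
sumFrom≡∑ lo zero      f = refl
sumFrom≡∑ lo (suc len) f = cong₂ ℚ._+_ (cong f (sym (ℕₚ.+-identityʳ lo))) (begin
  sumFrom (suc lo) len f                ≡⟨ sumFrom≡∑ (suc lo) len f ⟩
  ∑[ i < len ] f (suc lo ℕ.+ toℕ i)     ≡⟨ sum-cong-≗ {len} (λ i → cong f (ℕₚ.+-suc lo (toℕ i))) ⟨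
  ∑[ i < len ] f (lo ℕ.+ suc (toℕ i))   ∎)

*-*-distribˡ-S : ∀ x y e m →
  x ℚ.* (y ℚ.* S e m) ≡ ∑[ a < m ∸ 1 ] (x ℚ.* (y ℚ.* ℕtoℚ (suc (toℕ a) ℕ.^ e)))
*-*-distribˡ-S x y e m = begin
  x ℚ.* (y ℚ.* S e m)                ≡⟨ cong (λ s → x ℚ.* (y ℚ.* s)) (sumFrom≡∑ 1 (m ∸ 1) (λ ν → ℕtoℚ (ν ℕ.^ e))) ⟩
  x ℚ.* (y ℚ.* ∑[ a < m ∸ 1 ] aᵉ a)  ≡⟨ cong (x ℚ.*_) (*-distribˡ-sum y aᵉ) ⟩
  x ℚ.* ∑[ a < m ∸ 1 ] (y ℚ.* aᵉ a)  ≡⟨ *-distribˡ-sum x (λ a → y ℚ.* aᵉ a) ⟩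
  ∑[ a < m ∸ 1 ] (x ℚ.* (y ℚ.* aᵉ a)) ∎
  where
  aᵉ : Fin (m ∸ 1) → ℚ
  aᵉ a = ℕtoℚ (suc (toℕ a) ℕ.^ e)

binomial-x-1 : ∀ x n →
  (x ℚ.- 1ℚ) ^ℚ n ≡ ∑[ j ≤ n ] (ℕtoℚ (n C toℕ j) ℚ.* (sign (n ∸ toℕ j) ℚ.* x ^ℚ toℕ j))
binomial-x-1 x n = begin
  (x ℚ.- 1ℚ) ^ℚ n                                          ≡⟨ ^ℚ≡^ (x ℚ.- 1ℚ) n ⟩
  (x ℚ.- 1ℚ) ^ n                                           ≡⟨ Binomial.theorem n x (ℚ.- 1ℚ) ⟩
  ∑[ j ≤ n ] ((n C toℕ j) × (x ^ toℕ j ℚ.* (ℚ.- 1ℚ) ^ (n ∸ toℕ j))) ≡⟨ sum-cong-≗ {suc n} term ⟩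
  ∑[ j ≤ n ] (ℕtoℚ (n C toℕ j) ℚ.* (sign (n ∸ toℕ j) ℚ.* x ^ℚ toℕ j)) ∎
  where
  term : ∀ j → (n C toℕ j) × (x ^ toℕ j ℚ.* (ℚ.- 1ℚ) ^ (n ∸ toℕ j))
             ≡ ℕtoℚ (n C toℕ j) ℚ.* (sign (n ∸ toℕ j) ℚ.* x ^ℚ toℕ j)
  term j = trans (×≡ℕtoℚ-* (n C toℕ j) _) (cong (ℕtoℚ (n C toℕ j) ℚ.*_) (trans
    (ℚₚ.*-comm (x ^ toℕ j) _)
    (sym (cong₂ ℚ._*_ (^ℚ≡^ (ℚ.- 1ℚ) (n ∸ toℕ j)) (^ℚ≡^ x (toℕ j))))))

fermatQuotient-factor : ∀ p a .{{_ : NonZero p}} →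
  fermatQuotient p a ≡ ((+ 1) / p) ℚ.* (ℕtoℚ (a ℕ.^ (p ∸ 1)) ℚ.- 1ℚ)
fermatQuotient-factor p a {{p≢0}} = begin
  (aᵏ-1) / p
    ≡⟨ ℚₚ./-cong {{p≢0}} {{ℕₚ.m*n≢0 p 1}} (sym (ℤₚ.*-identityˡ aᵏ-1)) (sym (ℕₚ.*-identityʳ p)) ⟩
  ((+ 1 ℤ.* aᵏ-1) / (p ℕ.* 1)) {{ℕₚ.m*n≢0 p 1}}
    ≡⟨ /-*-/ (+ 1) aᵏ-1 p 1 ⟨
  ((+ 1) / p) ℚ.* (aᵏ-1 / 1)
    ≡⟨ cong (((+ 1) / p) ℚ.*_) (/-distribʳ-+ (+ (a ℕ.^ (p ∸ 1))) (ℤ.- + 1) 1) ⟩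
  ((+ 1) / p) ℚ.* (ℕtoℚ (a ℕ.^ (p ∸ 1)) ℚ.- 1ℚ) ∎
  where
  aᵏ-1 = + (a ℕ.^ (p ∸ 1)) ℤ.- + 1

fermatQuotient-^-expansion : ∀ p n a .{{_ : NonZero p}} →
  fermatQuotient p a ^ℚ n ≡
  ((+ 1) / (p ℕ.^ n)) {{m^n≢0 p n}} ℚ.*
    ∑[ j ≤ n ] (ℕtoℚ (n C toℕ j) ℚ.* (sign (n ∸ toℕ j) ℚ.* ℕtoℚ (a ℕ.^ (toℕ j ℕ.* (p ∸ 1)))))
fermatQuotient-^-expansion p n a = begin
  fermatQuotient p a ^ℚ n
    ≡⟨ cong (_^ℚ n) (fermatQuotient-factor p a) ⟩
  (((+ 1) / p) ℚ.* (ℕtoℚ aᵏ ℚ.- 1ℚ)) ^ℚ n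
    ≡⟨ ^ℚ-distrib-* ((+ 1) / p) (ℕtoℚ aᵏ ℚ.- 1ℚ) n ⟩
  ((+ 1) / p) ^ℚ n ℚ.* (ℕtoℚ aᵏ ℚ.- 1ℚ) ^ℚ n
    ≡⟨ cong₂ ℚ._*_ (1/-^ℚ p n) (binomial-x-1 (ℕtoℚ aᵏ) n) ⟩
  1/pⁿ ℚ.* ∑[ j ≤ n ] (ℕtoℚ (n C toℕ j) ℚ.* (sign (n ∸ toℕ j) ℚ.* ℕtoℚ aᵏ ^ℚ toℕ j))
    ≡⟨ cong (1/pⁿ ℚ.*_) (sum-cong-≗ {suc n} (λ j → cong (λ t → ℕtoℚ (n C toℕ j) ℚ.* (sign (n ∸ toℕ j) ℚ.* t)) (aᵏ^j j))) ⟩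
  1/pⁿ ℚ.* ∑[ j ≤ n ] (ℕtoℚ (n C toℕ j) ℚ.* (sign (n ∸ toℕ j) ℚ.* ℕtoℚ (a ℕ.^ (toℕ j ℕ.* (p ∸ 1))))) ∎
  where
  aᵏ = a ℕ.^ (p ∸ 1)
  1/pⁿ = ((+ 1) / (p ℕ.^ n)) {{m^n≢0 p n}}
  aᵏ^j : ∀ j → ℕtoℚ aᵏ ^ℚ toℕ j ≡ ℕtoℚ (a ℕ.^ (toℕ j ℕ.* (p ∸ 1)))
  aᵏ^j j = begin
    ℕtoℚ aᵏ ^ℚ toℕ j                    ≡⟨ ℕtoℚ-homo-^ aᵏ (toℕ j) ⟨
    ℕtoℚ (aᵏ ℕ.^ toℕ j)                 ≡⟨ cong ℕtoℚ (ℕₚ.^-*-assoc a (p ∸ 1) (toℕ j)) ⟩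
    ℕtoℚ (a ℕ.^ ((p ∸ 1) ℕ.* toℕ j))    ≡⟨ cong (λ e → ℕtoℚ (a ℕ.^ e)) (ℕₚ.*-comm (p ∸ 1) (toℕ j)) ⟩
    ℕtoℚ (a ℕ.^ (toℕ j ℕ.* (p ∸ 1)))    ∎

-- The identity holds for every p ≥ 1 and n ≥ 0.
lemma2p5 : (p n : ℕ) → .{{_ : NonZero p}} → Prime p → n ≥ 1 →
    Q p n ≡ ((+ 1) / (p ℕ.^ n)) {{m^n≢0 p n}} ℚ.* sum0 n (λ j → ℕtoℚ (n C j) ℚ.* (sign (n ∸ j) ℚ.* S (j ℕ.* (p ∸ 1)) p))
lemma2p5 p n _ _ = begin
  Q p n
    ≡⟨ sumFrom≡∑ 1 k (λ a → fermatQuotient p a ^ℚ n) ⟩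
  ∑[ a < k ] (fermatQuotient p (suc (toℕ a)) ^ℚ n)
    ≡⟨ sum-cong-≗ {k} (λ a → fermatQuotient-^-expansion p n (suc (toℕ a))) ⟩
  ∑[ a < k ] (1/pⁿ ℚ.* ∑[ j ≤ n ] T (suc (toℕ a)) (toℕ j))
    ≡⟨ *-distribˡ-sum {k} 1/pⁿ (λ a → ∑[ j ≤ n ] T (suc (toℕ a)) (toℕ j)) ⟨
  1/pⁿ ℚ.* ∑[ a < k ] ∑[ j ≤ n ] T (suc (toℕ a)) (toℕ j)
    ≡⟨ cong (1/pⁿ ℚ.*_) (∑-comm {k} {suc n} (λ a j → T (suc (toℕ a)) (toℕ j))) ⟩
  1/pⁿ ℚ.* ∑[ j ≤ n ] ∑[ a < k ] T (suc (toℕ a)) (toℕ j)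
    ≡⟨ cong (1/pⁿ ℚ.*_) (sum-cong-≗ {suc n} (λ j → sym (*-*-distribˡ-S (ℕtoℚ (n C toℕ j)) (sign (n ∸ toℕ j)) (toℕ j ℕ.* k) p))) ⟩
  1/pⁿ ℚ.* ∑[ j ≤ n ] (ℕtoℚ (n C toℕ j) ℚ.* (sign (n ∸ toℕ j) ℚ.* S (toℕ j ℕ.* k) p))
    ≡⟨ cong (1/pⁿ ℚ.*_) (sumFrom≡∑ 0 (suc n) (λ j → ℕtoℚ (n C j) ℚ.* (sign (n ∸ j) ℚ.* S (j ℕ.* k) p))) ⟨
  1/pⁿ ℚ.* sum0 n (λ j → ℕtoℚ (n C j) ℚ.* (sign (n ∸ j) ℚ.* S (j ℕ.* k) p)) ∎
  where
  k = p ∸ 1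
  1/pⁿ = ((+ 1) / (p ℕ.^ n)) {{m^n≢0 p n}}
  T : ℕ → ℕ → ℚ
  T a j = ℕtoℚ (n C j) ℚ.* (sign (n ∸ j) ℚ.* ℕtoℚ (a ℕ.^ (j ℕ.* k)))
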